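{- Let $\mathcal{E}$ be a well-pointed, locally finite cartesian closed category all of whose objects are inhabited, and let $\mathcal{R}$ be the CCC of logical relations from $\mathbf{FinSet}$ to $\mathcal{E}$. Then the full subcategory of $\mathcal{R}$ consisting of the objects $(Q,e,\Vdash)$ such that $\Vdash$ is a partial surjection is a sub-CCC of $\mathcal{R}$.
   Context: $\mathbf{FinSet}$ is the CCC of finite sets, where a finite set $Q$ is identified with its set of points. A CCC is well-pointed if morphisms are determined by their action on points ($1\to a$), locally finite if all hom-sets are finite, and an object is inhabited if it has at least one point. The CCC of logical relations $\mathcal{R}$ from $\mathbf{FinSet}$ to $\mathcal{E}$ has objects triples $(Q,e,\Vdash)$ with $Q$ a finite set, $e$ an object of $\mathcal{E}$, $\Vdash\subseteq Q\times\mathcal{E}(1,e)$; morphisms $(Q,e,\Vdash)\to(Q',e',\Vdash')$ are pairs $(f_1,f_2)$ with $f_1:Q\to Q'$, $f_2:e\to e'$ such that $q\Vdash x$ implies $f_1(q)\Vdash' f_2\circ x$. Its CCC structure: terminal object $(1,1,\text{full relation})$; product $(Q\times Q', e\times e', \Vdash^\times)$ with $(q,q')\Vdash^\times\langle x,x'\rangle$ iff $q\Vdash x$ and $q'\Vdash' x'$; exponential $(Q\Rightarrow Q', e\Rightarrow e', \Vdash^\Rightarrow)$ with $f\Vdash^\Rightarrow g$ iff for all $q\Vdash x$, $f(q)\Vdash' \mathrm{ev}\circ\langle g,x\rangle$. A relation $\Vdash\subseteq X_1\times X_2$ is a partial surjection if it is functional ($x_1\Vdash x_2$, $x_1\Vdash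 x_2'$ imply $x_2=x_2'$) and surjective (every $x_2$ is related to some $x_1$). -}

module Defs where

open import Level using (Level; _⊔_; suc)
open import Data.Nat using (ℕ)
open import Data.Fin using (Fin)
open import Data.Unit using (⊤; tt)
open import Data.Product using (Σ; _×_; _,_; proj₁; proj₂)
open import Relation.Binary.PropositionalEquality using (_≡_)

-- Cartesian closed categories (hom-sets compared with ≡, as in the
-- set-theoretic definition of a category).

record CCC (o ℓ : Level) : Set (suc (o ⊔ ℓ)) where
  infixr 9 _∘_
  infixr 7 _×ₒ_
  infixr 6 _⇒ₒ_
  field
    Obj  : Set o
    Hom  : Obj → Obj → Set ℓ
    id   : ∀ {a} → Hom a a
    _∘_  : ∀ {a b c} → Hom b c → Hom a b → Hom a c
    assoc : ∀ {a b c d} (h : Hom c d) (g : Hom b c) (f : Hom a b) →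
            (h ∘ g) ∘ f ≡ h ∘ (g ∘ f)
    identityˡ : ∀ {a b} (f : Hom a b) → id ∘ f ≡ f
    identityʳ : ∀ {a b} (f : Hom a b) → f ∘ id ≡ f
    𝟙    : Obj
    !    : ∀ {a} → Hom a 𝟙
    !-unique : ∀ {a} (f : Hom a 𝟙) → f ≡ !
    _×ₒ_ : Obj → Obj → Obj
    π₁   : ∀ {a b} → Hom (a ×ₒ b) a
    π₂   : ∀ {a b} → Hom (a ×ₒ b) b
    ⟨_,_⟩ : ∀ {c a b} → Hom c a → Hom c b → Hom c (a ×ₒ b)
    π₁-β : ∀ {c a b} (f : Hom c a) (g : Hom c b) → π₁ ∘ ⟨ f , g ⟩ ≡ f
    π₂-β : ∀ {c a b} (f : Hom c a) (g : Hom c b) → π₂ ∘ ⟨ f , g ⟩ ≡ g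
    ⟨⟩-unique : ∀ {c a b} (h : Hom c (a ×ₒ b)) → ⟨ π₁ ∘ h , π₂ ∘ h ⟩ ≡ h
    -- exponentials (a ⇒ₒ b is the exponential b^a)
    _⇒ₒ_ : Obj → Obj → Obj
    ev   : ∀ {a b} → Hom ((a ⇒ₒ b) ×ₒ a) b
    curry : ∀ {c a b} → Hom (c ×ₒ a) b → Hom c (a ⇒ₒ b)
    ev-β : ∀ {c a b} (f : Hom (c ×ₒ a) b) →
           ev ∘ ⟨ curry f ∘ π₁ , π₂ ⟩ ≡ f
    curry-unique : ∀ {c a b} (f : Hom (c ×ₒ a) b) (h : Hom c (a ⇒ₒ b)) →
           ev ∘ ⟨ h ∘ π₁ , π₂ ⟩ ≡ f → h ≡ curry f

  Point : Obj → Set ℓ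
  Point a = Hom 𝟙 a

module _ {o ℓ : Level} (E : CCC o ℓ) where
  open CCC E

  WellPointed : Set (o ⊔ ℓ)
  WellPointed = ∀ {a b} (f g : Hom a b) →
                (∀ (x : Point a) → f ∘ x ≡ g ∘ x) → f ≡ g

  FiniteSet : ∀ {p} → Set p → Set p
  FiniteSet A = Σ ℕ λ n → Σ (Fin n → A) λ enum → ∀ (x : A) → Σ (Fin n) λ i → enum i ≡ x

  LocallyFinite : Set (o ⊔ ℓ)
  LocallyFinite = ∀ (a b : Obj) → FiniteSet (Hom a b)

  AllInhabited : Set (o ⊔ ℓ)
  AllInhabited = ∀ (a : Obj) → Point a

-- FinSet: objects are codes for finite sets, closed under the CCC
-- constructions (every finite set is, up to bijection, some fin n).

data FinObj : Set where
  fin  : ℕ → FinObj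
  one  : FinObj
  _⊗_  : FinObj → FinObj → FinObj
  _⇛_  : FinObj → FinObj → FinObj

El : FinObj → Set
El (fin n) = Fin n
El one     = ⊤
El (Q ⊗ Q') = El Q × El Q'
El (Q ⇛ Q') = El Q → El Q'

module LogRel {o ℓ : Level} (E : CCC o ℓ) where
  open CCC E

  record RObj : Set (o ⊔ suc ℓ) where
    constructor robj
    field
      Q   : FinObj
      e   : Obj
      rel : El Q → Point e → Set ℓ

  open RObj public

  record RHom (A B : RObj) : Set ℓ where
    constructor rhom
    field
      f₁ : El (Q A) → El (Q B)
      f₂ : Hom (e A) (e B)
      preserves : ∀ q x → rel A q x → rel B (f₁ q) (f₂ ∘ x)

  R𝟙 : RObj
  R𝟙 = robj one 𝟙 (λ _ _ → Level.Lift ℓ ⊤)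

  _R×_ : RObj → RObj → RObj
  A R× B = robj (Q A ⊗ Q B) (e A ×ₒ e B)
    (λ { (q , q') z → rel A q (π₁ ∘ z) × rel B q' (π₂ ∘ z) })

  _R⇒_ : RObj → RObj → RObj
  A R⇒ B = robj (Q A ⇛ Q B) (e A ⇒ₒ e B)
    (λ f g → ∀ q x → rel A q x → rel B (f q) (ev ∘ ⟨ g , x ⟩))

  -- partial surjections (functional and surjective)
  IsPartialSurjection : RObj → Set ℓ
  IsPartialSurjection A =
    (∀ (q : El (Q A)) (x x' : Point (e A)) → rel A q x → rel A q x' → x ≡ x')
    × (∀ (x : Point (e A)) → Σ (El (Q A)) λ q → rel A q x)

  -- the full subcategory of partial surjections is a sub-CCC:
  -- it contains the terminal object and is closed under products
  -- and exponentials (fullness gives all structure morphisms).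
  SubCCCOfPartialSurjections : Set (o ⊔ suc ℓ)
  SubCCCOfPartialSurjections =
    IsPartialSurjection R𝟙
    × (∀ A B → IsPartialSurjection A → IsPartialSurjection B →
         IsPartialSurjection (A R× B))
    × (∀ A B → IsPartialSurjection A → IsPartialSurjection B →
         IsPartialSurjection (A R⇒ B))

-- Functionality of an exponential relation is extensionality: two realized points of e ⇒ e'
-- agree on every point of e (each is realized, by surjectivity), hence are equal since E is
-- well-pointed.  Surjectivity of an exponential relation asks, for each point g of e ⇒ e', for a
-- map of finite sets tracking g: a state q realizing some point x is sent to a realizer of
-- ev ∘ ⟨ g , x ⟩, which does not depend on the choice of x by functionality; any other state goes
-- to an arbitrary realizer, which exists because the codomain object is inhabited.  Deciding
-- whether q realizes a point is where excluded middle enters.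
module Submission where

open import Defs
open import Axiom.ExcludedMiddle using (ExcludedMiddle)
open import Data.Product using (Σ; _,_; proj₁; proj₂)
open import Data.Unit using (tt)
open import Data.Empty using (⊥-elim)
open import Relation.Nullary using (yes; no)
open import Relation.Binary.PropositionalEquality
  using (_≡_; refl; sym; trans; cong; cong₂; subst; module ≡-Reasoning)

module CCCProperties {o ℓ} (E : CCC o ℓ) where
  open CCC E
  open ≡-Reasoning

  ⟨⟩∘ : ∀ {c d a b} (f : Hom c a) (g : Hom c b) (h : Hom d c) →
        ⟨ f , g ⟩ ∘ h ≡ ⟨ f ∘ h , g ∘ h ⟩
  ⟨⟩∘ f g h = begin
    ⟨ f , g ⟩ ∘ h                                   ≡⟨ sym (⟨⟩-unique (⟨ f , g ⟩ ∘ h)) ⟩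
    ⟨ π₁ ∘ ⟨ f , g ⟩ ∘ h , π₂ ∘ ⟨ f , g ⟩ ∘ h ⟩     ≡⟨ cong₂ ⟨_,_⟩ π₁-step π₂-step ⟩
    ⟨ f ∘ h , g ∘ h ⟩                               ∎
    where
    π₁-step : π₁ ∘ ⟨ f , g ⟩ ∘ h ≡ f ∘ h
    π₁-step = trans (sym (assoc π₁ ⟨ f , g ⟩ h)) (cong (_∘ h) (π₁-β f g))
    π₂-step : π₂ ∘ ⟨ f , g ⟩ ∘ h ≡ g ∘ h
    π₂-step = trans (sym (assoc π₂ ⟨ f , g ⟩ h)) (cong (_∘ h) (π₂-β f g))

  𝟙-η : ∀ {a} (f g : Hom a 𝟙) → f ≡ g
  𝟙-η f g = trans (!-unique f) (sym (!-unique g))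

  ×-ext : ∀ {c a b} {z z' : Hom c (a ×ₒ b)} →
          π₁ ∘ z ≡ π₁ ∘ z' → π₂ ∘ z ≡ π₂ ∘ z' → z ≡ z'
  ×-ext {z = z} {z'} eq₁ eq₂ = begin
    z                        ≡⟨ sym (⟨⟩-unique z) ⟩
    ⟨ π₁ ∘ z , π₂ ∘ z ⟩      ≡⟨ cong₂ ⟨_,_⟩ eq₁ eq₂ ⟩
    ⟨ π₁ ∘ z' , π₂ ∘ z' ⟩    ≡⟨ ⟨⟩-unique z' ⟩
    z'                       ∎

  uncurry-point : ∀ {a b} (g : Point (a ⇒ₒ b)) (p : Point (𝟙 ×ₒ a)) →
                  (ev ∘ ⟨ g ∘ π₁ , π₂ ⟩) ∘ p ≡ ev ∘ ⟨ g , π₂ ∘ p ⟩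
  uncurry-point g p = begin
    (ev ∘ ⟨ g ∘ π₁ , π₂ ⟩) ∘ p          ≡⟨ assoc ev _ p ⟩
    ev ∘ ⟨ g ∘ π₁ , π₂ ⟩ ∘ p            ≡⟨ cong (ev ∘_) (⟨⟩∘ (g ∘ π₁) π₂ p) ⟩
    ev ∘ ⟨ (g ∘ π₁) ∘ p , π₂ ∘ p ⟩      ≡⟨ cong (λ k → ev ∘ ⟨ k , π₂ ∘ p ⟩) g∘π₁∘p≡g ⟩
    ev ∘ ⟨ g , π₂ ∘ p ⟩                 ∎
    where
    g∘π₁∘p≡g : (g ∘ π₁) ∘ p ≡ g
    g∘π₁∘p≡g = begin
      (g ∘ π₁) ∘ p   ≡⟨ assoc g π₁ p ⟩
      g ∘ (π₁ ∘ p)   ≡⟨ cong (g ∘_) (𝟙-η (π₁ ∘ p) id) ⟩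
      g ∘ id         ≡⟨ identityʳ g ⟩
      g              ∎

  ⇒-point-ext : WellPointed E → ∀ {a b} (g g' : Point (a ⇒ₒ b)) →
                (∀ x → ev ∘ ⟨ g , x ⟩ ≡ ev ∘ ⟨ g' , x ⟩) → g ≡ g'
  ⇒-point-ext wp g g' pointwise =
    trans (curry-unique _ g refl) (sym (curry-unique _ g' (sym uncurried-equal)))
    where
    uncurried-equal : ev ∘ ⟨ g ∘ π₁ , π₂ ⟩ ≡ ev ∘ ⟨ g' ∘ π₁ , π₂ ⟩
    uncurried-equal = wp _ _ λ p → begin
      (ev ∘ ⟨ g ∘ π₁ , π₂ ⟩) ∘ p     ≡⟨ uncurry-point g p ⟩
      ev ∘ ⟨ g , π₂ ∘ p ⟩            ≡⟨ pointwise (π₂ ∘ p) ⟩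
      ev ∘ ⟨ g' , π₂ ∘ p ⟩           ≡⟨ sym (uncurry-point g' p) ⟩
      (ev ∘ ⟨ g' ∘ π₁ , π₂ ⟩) ∘ p    ∎

module PartialSurjections {o ℓ} (E : CCC o ℓ) where
  open CCC E
  open LogRel E
  open CCCProperties E

  Functional : RObj → Set ℓ
  Functional A = ∀ q (x x' : Point (e A)) → rel A q x → rel A q x' → x ≡ x'

  Surjective : RObj → Set ℓ
  Surjective A = ∀ (x : Point (e A)) → Σ (El (Q A)) λ q → rel A q x

  R𝟙-partialSurjection : IsPartialSurjection R𝟙
  R𝟙-partialSurjection = (λ _ x x' _ _ → 𝟙-η x x') , (λ _ → tt , _)

  R×-functional : ∀ A B → Functional A → Functional B → Functional (A R× B)
  R×-functional A B funA funB (q , q') z z' (q⊩z₁ , q'⊩z₂) (q⊩z'₁ , q'⊩z'₂) =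
    ×-ext (funA q _ _ q⊩z₁ q⊩z'₁) (funB q' _ _ q'⊩z₂ q'⊩z'₂)

  R×-surjective : ∀ A B → Surjective A → Surjective B → Surjective (A R× B)
  R×-surjective A B surA surB z =
    (proj₁ (surA (π₁ ∘ z)) , proj₁ (surB (π₂ ∘ z))) , proj₂ (surA (π₁ ∘ z)) , proj₂ (surB (π₂ ∘ z))

  R⇒-functional : WellPointed E → ∀ A B → Surjective A → Functional B → Functional (A R⇒ B)
  R⇒-functional wp A B surA funB f g g' f⊩g f⊩g' = ⇒-point-ext wp g g' λ x →
    let (q , q⊩x) = surA x in funB (f q) _ _ (f⊩g q x q⊩x) (f⊩g' q x q⊩x)

  R⇒-surjective : ExcludedMiddle ℓ → ∀ A B → Point (e B) →
                  Functional A → Surjective B → Surjective (A R⇒ B)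
  R⇒-surjective em A B y₀ funA surB g = (λ q → proj₁ (tracking q)) , (λ q → proj₂ (tracking q))
    where
    tracking : (q : El (Q A)) → Σ (El (Q B)) λ q' → ∀ x → rel A q x → rel B q' (ev ∘ ⟨ g , x ⟩)
    tracking q with em {Σ (Point (e A)) (rel A q)}
    ... | yes (x₀ , q⊩x₀) =
      let (q' , q'⊩gx₀) = surB (ev ∘ ⟨ g , x₀ ⟩) in
      q' , λ x q⊩x → subst (λ y → rel B q' (ev ∘ ⟨ g , y ⟩)) (funA q x₀ x q⊩x₀ q⊩x) q'⊩gx₀
    ... | no no-point = proj₁ (surB y₀) , λ x q⊩x → ⊥-elim (no-point (x , q⊩x))

proposition5p8 : ∀ {o ℓ} → ExcludedMiddle ℓ → (E : CCC o ℓ) → WellPointed E → LocallyFinite E → AllInhabited E → LogRel.SubCCCOfPartialSurjections E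
proposition5p8 em E wp _ inhabited =
    R𝟙-partialSurjection
  , (λ A B (funA , surA) (funB , surB) →
       R×-functional A B funA funB , R×-surjective A B surA surB)
  , (λ A B (funA , surA) (funB , surB) →
       R⇒-functional wp A B surA funB , R⇒-surjective em A B (inhabited (e B)) funA surB)
  where
  open LogRel E
  open PartialSurjections E
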